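{- Let $F$ be a gene tree forest and $H(F)$ the edge-labeled graph associated to $F$. Then the minimum, over all bipartitions $B$ of $L(F)$, of the label-size of the edge-cut $E(B)$ of $H(F)$ is equal to the minimum size $|I|$ of a prefix $I$ of $F$ such that $|P(I)|\geq 2$.
   Context: A gene tree is a rooted binary tree (internal vertex $x$ has children $x_l,x_r$) whose leaves are labeled by genome labels (labels may repeat); a gene tree forest $F$ is a finite set of gene trees. $L(x)$ is the set of leaf labels in the subtree rooted at $x$, and $L(F)$ the set of all leaf labels of $F$. Label the internal vertices of $F$ injectively by $1,\dots,m$. The graph $H(F)$ has vertex set $L(F)$ and, for each internal vertex $x$ with label $a$ and each pair of distinct $s,t$ with $\{s,t\}\subseteq L(x_l)$ or $\{s,t\}\subseteq L(x_r)$, an edge between $s$ and $t$ labeled $a$. A bipartition $B=(V_1,V_2)$ of $L(F)$ is a pair of disjoint nonempty sets with union $L(F)$; $E(B)$ is the set of edges of $H(F)$ with one endpoint in $V_1$ and one in $V_2$, and its label-size is the number of distinct labels on its edges. A prefix of $F$ is a set $I$ of vertices of $F$ such that every ancestor of a vertex of $I$ is in $I$. $P(I)$ is the partition of $L(F)$ into the connected components of the graph obtained from $H(F)$ by deleting all edges whose label is the label of a vertex in $I$; $|P(I)|$ is its number of parts. -}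

module Defs where

open import Level using (0ℓ)
open import Data.Nat using (ℕ; _≤_)
open import Data.Empty using (⊥)
open import Data.Product using (Σ; ∃; _×_; _,_)
open import Data.Sum using (_⊎_)
open import Data.List using (List; []; _∷_; _++_; concatMap; length)
open import Data.List.Membership.Propositional using (_∈_)
open import Data.List.Relation.Unary.Any using (Any; here; there)
open import Data.List.Relation.Unary.All using (All)
open import Data.List.Relation.Unary.AllPairs using (AllPairs)
open import Data.List.Relation.Unary.Unique.Propositional using (Unique)
open import Relation.Binary.PropositionalEquality using (_≡_; _≢_)
open import Relation.Nullary using (¬_)
open import Function.Bundles using (_⇔_)

Label : Set
Label = ℕ

-- Rooted binary gene trees with labelled leaves (labels may repeat).
data Tree : Set where
  leaf : Label → Tree
  node : Tree → Tree → Tree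

Forest : Set
Forest = List Tree

-- Leaf labels of a tree (as a list; membership = the set L(t)).
leaves : Tree → List Label
leaves (leaf a)   = a ∷ []
leaves (node l r) = leaves l ++ leaves r

labelsF : Forest → List Label
labelsF F = concatMap leaves F

-- Vertices (positions) of a tree: the root, or a vertex in the left / right subtree.
data Pos : Tree → Set where
  root  : ∀ {t} → Pos t
  left  : ∀ {l r} → Pos l → Pos (node l r)
  right : ∀ {l r} → Pos r → Pos (node l r)

subtree : (t : Tree) → Pos t → Tree
subtree t         root      = t
subtree (node l r) (left p)  = subtree l p
subtree (node l r) (right p) = subtree r p

-- Proper ancestor relation inside a tree: p ⊏ q means p is a proper ancestor of q.
data _⊏_ : {t : Tree} → Pos t → Pos t → Set where
  root-left  : ∀ {l r} {p : Pos l} → root {node l r} ⊏ left p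
  root-right : ∀ {l r} {p : Pos r} → root {node l r} ⊏ right p
  left-left  : ∀ {l r} {p q : Pos l} → p ⊏ q → left {l} {r} p ⊏ left q
  right-right : ∀ {l r} {p q : Pos r} → p ⊏ q → right {l} {r} p ⊏ right q

Vertex : Forest → Set
Vertex F = Any Pos F

subtreeF : {F : Forest} → Vertex F → Tree
subtreeF (here {x = t} p) = subtree t p
subtreeF (there v)        = subtreeF v

data _⊏F_ : {F : Forest} → Vertex F → Vertex F → Set where
  here  : ∀ {t F} {p q : Pos t} → p ⊏ q → here {P = Pos} {x = t} {xs = F} p ⊏F here q
  there : ∀ {t F} {u v : Vertex F} → u ⊏F v → there {P = Pos} {x = t} u ⊏F there v

-- Edges of H(F): an edge between distinct s and t labelled by the internal vertex v
-- (vertices are their own labels, which is an injective labelling) whenever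
-- {s,t} ⊆ L(v_l) or {s,t} ⊆ L(v_r).
Edge : (F : Forest) → Vertex F → Label → Label → Set
Edge F v s t =
  s ≢ t × Σ Tree λ l → Σ Tree λ r → subtreeF v ≡ node l r ×
    ((s ∈ leaves l × t ∈ leaves l) ⊎ (s ∈ leaves r × t ∈ leaves r))

HasSize : {A : Set} → (A → Set) → ℕ → Set
HasSize {A} P k = Σ (List A) λ xs → Unique xs × (∀ x → (x ∈ xs) ⇔ P x) × length xs ≡ k

record Bipartition (F : Forest) : Set₁ where
  field
    V₁ V₂    : Label → Set
    disjoint : ∀ s → V₁ s → V₂ s → ⊥
    cover    : ∀ s → (s ∈ labelsF F) ⇔ (V₁ s ⊎ V₂ s)
    nonempty₁ : ∃ V₁
    nonempty₂ : ∃ V₂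

-- The label a (= internal vertex v) occurs on some edge of the cut E(B).
CutLabel : {F : Forest} → Bipartition F → Vertex F → Set
CutLabel {F} B v = ∃ λ s → ∃ λ t → Edge F v s t ×
  ((V₁ s × V₂ t) ⊎ (V₂ s × V₁ t))
  where open Bipartition B

LabelSize : {F : Forest} → Bipartition F → ℕ → Set
LabelSize B k = HasSize (CutLabel B) k

IsPrefix : (F : Forest) → (Vertex F → Set) → Set
IsPrefix F I = ∀ (u v : Vertex F) → u ⊏F v → I v → I u

-- Connectivity in H(F) with all edges labelled by vertices of I deleted.
data Conn (F : Forest) (I : Vertex F → Set) : Label → Label → Set where
  refl : ∀ {s} → Conn F I s s
  step : ∀ {s u t} (v : Vertex F) → Conn F I s u → ¬ I v → Edge F v u t → Conn F I s t

-- |P(I)| = n : there are n labels of L(F), pairwise in different components,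
-- such that every label of L(F) is in the component of one of them.
Parts : (F : Forest) → (Vertex F → Set) → ℕ → Set
Parts F I n = Σ (List Label) λ reps → length reps ≡ n
  × All (λ r → r ∈ labelsF F) reps
  × AllPairs (λ a b → ¬ Conn F I a b) reps
  × (∀ s → s ∈ labelsF F → Any (λ r → Conn F I s r) reps)

AtLeastTwoParts : (F : Forest) → (Vertex F → Set) → Set
AtLeastTwoParts F I = ∃ λ n → Parts F I n × 2 ≤ n

MinCut : Forest → ℕ → Set₁
MinCut F k = (Σ (Bipartition F) λ B → LabelSize B k)
  × (∀ (B : Bipartition F) k′ → LabelSize B k′ → k ≤ k′)

MinPrefix : Forest → ℕ → Set₁
MinPrefix F k = (Σ (Vertex F → Set) λ I → IsPrefix F I × HasSize I k × AtLeastTwoParts F I)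
  × (∀ (I : Vertex F → Set) k′ → IsPrefix F I → HasSize I k′ → AtLeastTwoParts F I → k ≤ k′)

module Submission where

-- The labels on the edges crossing a bipartition form a prefix, since an edge labelled v is
-- also labelled by every ancestor of v; deleting them disconnects the two sides, so every
-- bipartition yields a prefix of the same size with at least two parts. Conversely, if
-- deleting the labels of I leaves at least two components, one component against the rest is
-- a bipartition all of whose cut labels lie in I. So each minimum bounds the other.
-- Constructively, the parts of P(I) are obtained by deciding connectivity through a closure
-- search over the finitely many labels of F.

open import Defs
open import Level using (0ℓ)
open import Data.Nat using (ℕ; suc; _≤_; _<_; z≤n; s≤s; s≤s⁻¹)
open import Data.Nat.Properties using (≤-refl; ≤-trans; ≤-antisym; <-≤-trans)
  renaming (_≟_ to _≟ℕ_)
open import Data.Empty using (⊥-elim)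
open import Data.Product using (Σ; ∃; _×_; _,_; proj₁; proj₂)
open import Data.Sum using (_⊎_; inj₁; inj₂)
open import Data.List using (List; []; _∷_; _++_; length; map; filter; deduplicate)
open import Data.List.Properties using (length-filter; filter-notAll)
open import Data.List.Membership.Propositional using (_∈_; find; lose)
open import Data.List.Membership.Propositional.Properties using (∈-map⁺; ∈-++⁺ˡ; ∈-++⁺ʳ; ∈-filter⁺; ∈-filter⁻)
open import Data.List.Membership.DecPropositional _≟ℕ_ using (_∈?_)
open import Data.List.Relation.Binary.Subset.Propositional using () renaming (_⊆_ to _⊆ˡ_)
open import Data.List.Relation.Unary.Any as Any using (Any; here; there; any?)
open import Data.List.Relation.Unary.Any.Properties as Anyₚ using ()
open import Data.List.Relation.Unary.All as All using (All; []; _∷_)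
open import Data.List.Relation.Unary.All.Properties as Allₚ using ()
open import Data.List.Relation.Unary.AllPairs using (_∷_)
import Data.List.Relation.Unary.Unique.Propositional.Properties as Unique
open import Data.List.Relation.Unary.Unique.DecSetoid.Properties using (deduplicate-!)
open import Relation.Binary using (Rel; DecSetoid; DecidableEquality) renaming (Decidable to Decidable₂)
open import Relation.Binary.Construct.Closure.ReflexiveTransitive using (Star; ε; _◅_; _◅◅_)
open import Relation.Binary.PropositionalEquality using (_≡_; refl; sym; subst)
open import Relation.Nullary using (¬_; Dec; yes; no)
open import Relation.Nullary.Decidable using (map′; ¬?; _×-dec_; _⊎-dec_; decidable-stable)
open import Relation.Unary using (Pred; Decidable; _⊆_)
open import Function using (_∘_; case_of_)
open import Function.Bundles using (_⇔_; mk⇔; Equivalence)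
open Equivalence using (to; from)

∃?-bounded : {A : Set} {P : Pred A 0ℓ} (xs : List A) → (∀ {x} → P x → x ∈ xs) →
             Decidable P → Dec (∃ P)
∃?-bounded xs bound P? =
  map′ (λ p → let (x , _ , px) = find p in x , px) (λ (x , px) → lose (bound px) px) (any? P? xs)

HasSize⇒Decidable : {A : Set} {P : Pred A 0ℓ} {k : ℕ} → DecidableEquality A → HasSize P k → Decidable P
HasSize⇒Decidable _≟_ (xs , _ , xs⇔P , _) x = map′ (to (xs⇔P x)) (from (xs⇔P x)) (any? (x ≟_) xs)

HasSize-⊆ : {A : Set} {P Q : Pred A 0ℓ} {k : ℕ} → Decidable Q → Q ⊆ P → HasSize P k →
            ∃ λ k′ → HasSize Q k′ × k′ ≤ k
HasSize-⊆ {Q = Q} Q? Q⊆P (xs , unique , xs⇔P , refl) =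
  length (filter Q? xs) ,
  (filter Q? xs , Unique.filter⁺ Q? unique , ys⇔Q , refl) ,
  length-filter Q? xs
  where
    ys⇔Q : ∀ x → (x ∈ filter Q? xs) ⇔ Q x
    ys⇔Q x = mk⇔ (proj₂ ∘ ∈-filter⁻ Q? {xs = xs}) (λ q → ∈-filter⁺ Q? (from (xs⇔P x) (Q⊆P q)) q)

module Reachability {A : Set} (_≟_ : DecidableEquality A) {_⟶_ : Rel A 0ℓ} (_⟶?_ : Decidable₂ _⟶_)
                    (U : List A) (⟶-target : ∀ {a b} → a ⟶ b → b ∈ U) where

  Adjacent : List A → Pred A 0ℓ
  Adjacent R b = Any (_⟶ b) R

  adjacent? : ∀ R → Decidable (Adjacent R)
  adjacent? R b = any? (_⟶? b) R

  record Closure (s : A) : Set where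
    field
      members   : List A
      start     : s ∈ members
      reachable : All (Star _⟶_ s) members
      closed    : ∀ {a b} → a ∈ members → a ⟶ b → b ∈ members

    closed⋆ : ∀ {a b} → a ∈ members → Star _⟶_ a b → b ∈ members
    closed⋆ a∈R ε          = a∈R
    closed⋆ a∈R (a⟶ ◅ ⟶⋆) = closed⋆ (closed a∈R a⟶) ⟶⋆

  reachable-adjacent : ∀ {s b R} → All (Star _⟶_ s) R → Adjacent R b → Star _⟶_ s b
  reachable-adjacent reach adj = let (a , a∈R , a⟶b) = find adj in All.lookup reach a∈R ◅◅ (a⟶b ◅ ε)

  -- Each round moves the vertices of W adjacent to R into R; since W shrinks, n rounds suffice.
  explore : ∀ {s} n (R W : List A) → length W < n → s ∈ R → All (Star _⟶_ s) R →
            (∀ {b} → b ∈ U → b ∈ R ⊎ b ∈ W) → Closure s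
  explore (suc n) R W |W|<n s∈R reach split with any? (adjacent? R) W
  ... | no none = record { members = R ; start = s∈R ; reachable = reach ; closed = closed }
    where
      closed : ∀ {a b} → a ∈ R → a ⟶ b → b ∈ R
      closed {b = b} a∈R a⟶b with split (⟶-target a⟶b)
      ... | inj₁ b∈R = b∈R
      ... | inj₂ b∈W = ⊥-elim (none (lose b∈W (lose {P = _⟶ b} a∈R a⟶b)))
  ... | yes some =
    explore n (new ++ R) rest (<-≤-trans shorter (s≤s⁻¹ |W|<n)) (∈-++⁺ʳ new s∈R)
      (Allₚ.++⁺ (All.tabulate (reachable-adjacent reach ∘ proj₂ ∘ ∈-filter⁻ (adjacent? R) {xs = W})) reach)
      split′
    where
      new rest : List A
      new  = filter (adjacent? R) W
      rest = filter (¬? ∘ adjacent? R) W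

      shorter : length rest < length W
      shorter = filter-notAll (¬? ∘ adjacent? R) W (Any.map (λ adj ¬adj → ¬adj adj) some)

      split′ : ∀ {b} → b ∈ U → b ∈ new ++ R ⊎ b ∈ rest
      split′ {b} b∈U with split b∈U
      ... | inj₁ b∈R = inj₁ (∈-++⁺ʳ new b∈R)
      ... | inj₂ b∈W with adjacent? R b
      ...   | yes adj = inj₁ (∈-++⁺ˡ (∈-filter⁺ (adjacent? R) b∈W adj))
      ...   | no ¬adj = inj₂ (∈-filter⁺ (¬? ∘ adjacent? R) b∈W ¬adj)

  closure : ∀ s → Closure s
  closure s = explore (suc (length U)) (s ∷ []) U ≤-refl (here refl) (ε ∷ []) inj₂

  reachable? : Decidable₂ (Star _⟶_)
  reachable? s t = map′ (All.lookup reachable) (closed⋆ start) (any? (t ≟_) members)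
    where open Closure (closure s)

_≟ᵖ_ : ∀ {t} → DecidableEquality (Pos t)
root    ≟ᵖ root    = yes refl
left p  ≟ᵖ left q  with p ≟ᵖ q
... | yes refl = yes refl
... | no p≢q   = no λ { refl → p≢q refl }
right p ≟ᵖ right q with p ≟ᵖ q
... | yes refl = yes refl
... | no p≢q   = no λ { refl → p≢q refl }
root    ≟ᵖ left _  = no λ ()
root    ≟ᵖ right _ = no λ ()
left _  ≟ᵖ root    = no λ ()
left _  ≟ᵖ right _ = no λ ()
right _ ≟ᵖ root    = no λ ()
right _ ≟ᵖ left _  = no λ ()

_≟ᵛ_ : ∀ {F} → DecidableEquality (Vertex F)
here p  ≟ᵛ here q  with p ≟ᵖ q
... | yes refl = yes refl
... | no p≢q   = no λ { refl → p≢q refl }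
there u ≟ᵛ there v with u ≟ᵛ v
... | yes refl = yes refl
... | no u≢v   = no λ { refl → u≢v refl }
here _  ≟ᵛ there _ = no λ ()
there _ ≟ᵛ here _  = no λ ()

positions : (t : Tree) → List (Pos t)
positions (leaf _)   = root ∷ []
positions (node l r) = root ∷ map left (positions l) ++ map right (positions r)

∈-positions : ∀ t (p : Pos t) → p ∈ positions t
∈-positions (leaf _)   root      = here refl
∈-positions (node l r) root      = here refl
∈-positions (node l r) (left p)  = there (∈-++⁺ˡ (∈-map⁺ left (∈-positions l p)))
∈-positions (node l r) (right p) = there (∈-++⁺ʳ _ (∈-map⁺ right (∈-positions r p)))

vertices : (F : Forest) → List (Vertex F)
vertices []      = []
vertices (t ∷ F) = map here (positions t) ++ map there (vertices F)

∈-vertices : ∀ {F} (v : Vertex F) → v ∈ vertices F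
∈-vertices {t ∷ F} (here p)  = ∈-++⁺ˡ (∈-map⁺ here (∈-positions t p))
∈-vertices {t ∷ F} (there v) = ∈-++⁺ʳ _ (∈-map⁺ there (∈-vertices v))

leaves-subtree : ∀ t (p : Pos t) → leaves (subtree t p) ⊆ˡ leaves t
leaves-subtree t          root      = λ x∈ → x∈
leaves-subtree (node l r) (left p)  = ∈-++⁺ˡ ∘ leaves-subtree l p
leaves-subtree (node l r) (right p) = ∈-++⁺ʳ (leaves l) ∘ leaves-subtree r p

leaves-subtreeF : ∀ {F} (v : Vertex F) → leaves (subtreeF v) ⊆ˡ labelsF F
leaves-subtreeF {t ∷ F} (here p)  = ∈-++⁺ˡ ∘ leaves-subtree t p
leaves-subtreeF {t ∷ F} (there v) = ∈-++⁺ʳ (leaves t) ∘ leaves-subtreeF v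

module _ {F : Forest} where

  Edge-sym : ∀ v {s t} → Edge F v s t → Edge F v t s
  Edge-sym v (s≢t , l , r , eq , inj₁ (s∈ , t∈)) = s≢t ∘ sym , l , r , eq , inj₁ (t∈ , s∈)
  Edge-sym v (s≢t , l , r , eq , inj₂ (s∈ , t∈)) = s≢t ∘ sym , l , r , eq , inj₂ (t∈ , s∈)

  Edge-endpoints : ∀ v {s t} → Edge F v s t → s ∈ leaves (subtreeF v) × t ∈ leaves (subtreeF v)
  Edge-endpoints v (_ , l , r , eq , side) = subst (λ T → _ ∈ leaves T × _ ∈ leaves T) (sym eq) (both side)
    where
      both : ∀ {s t} → (s ∈ leaves l × t ∈ leaves l) ⊎ (s ∈ leaves r × t ∈ leaves r) →
             s ∈ leaves (node l r) × t ∈ leaves (node l r)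
      both (inj₁ (s∈ , t∈)) = ∈-++⁺ˡ s∈ , ∈-++⁺ˡ t∈
      both (inj₂ (s∈ , t∈)) = ∈-++⁺ʳ (leaves l) s∈ , ∈-++⁺ʳ (leaves l) t∈

  Edge-labels : ∀ v {s t} → Edge F v s t → s ∈ labelsF F × t ∈ labelsF F
  Edge-labels v e = let (s∈ , t∈) = Edge-endpoints v e in leaves-subtreeF v s∈ , leaves-subtreeF v t∈

  Edge? : ∀ v s t → Dec (Edge F v s t)
  Edge? v s t with s ≟ℕ t | subtreeF v
  ... | yes s≡t | _        = no λ e → proj₁ e s≡t
  ... | no s≢t  | leaf _   = no λ { (_ , _ , _ , () , _) }
  ... | no s≢t  | node l r =
    map′ (λ side → s≢t , l , r , refl , side) (λ { (_ , _ , _ , refl , side) → side })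
         (((s ∈? leaves l) ×-dec (t ∈? leaves l)) ⊎-dec ((s ∈? leaves r) ×-dec (t ∈? leaves r)))

⊏-child : ∀ {t} {p q : Pos t} → p ⊏ q → Σ Tree λ l → Σ Tree λ r → subtree t p ≡ node l r ×
          (leaves (subtree t q) ⊆ˡ leaves l ⊎ leaves (subtree t q) ⊆ˡ leaves r)
⊏-child (root-left {l} {r} {p})  = l , r , refl , inj₁ (leaves-subtree l p)
⊏-child (root-right {l} {r} {p}) = l , r , refl , inj₂ (leaves-subtree r p)
⊏-child (left-left p⊏q)          = ⊏-child p⊏q
⊏-child (right-right p⊏q)        = ⊏-child p⊏q

⊏F-child : ∀ {F} {u v : Vertex F} → u ⊏F v → Σ Tree λ l → Σ Tree λ r → subtreeF u ≡ node l r ×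
           (leaves (subtreeF v) ⊆ˡ leaves l ⊎ leaves (subtreeF v) ⊆ˡ leaves r)
⊏F-child (here p⊏q)  = ⊏-child p⊏q
⊏F-child (there u⊏v) = ⊏F-child u⊏v

Edge-ancestor : ∀ {F} {u v : Vertex F} → u ⊏F v → ∀ {s t} → Edge F v s t → Edge F u s t
Edge-ancestor {v = v} u⊏v e@(s≢t , _) with ⊏F-child u⊏v | Edge-endpoints v e
... | l , r , eq , inj₁ ⊆l | s∈ , t∈ = s≢t , l , r , eq , inj₁ (⊆l s∈ , ⊆l t∈)
... | l , r , eq , inj₂ ⊆r | s∈ , t∈ = s≢t , l , r , eq , inj₂ (⊆r s∈ , ⊆r t∈)

CutLabel-isPrefix : ∀ {F} (B : Bipartition F) → IsPrefix F (CutLabel B)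
CutLabel-isPrefix B u v u⊏v (s , t , e , crossing) = s , t , Edge-ancestor u⊏v e , crossing

CutLabel? : ∀ {F} (B : Bipartition F) → Decidable (Bipartition.V₁ B) → Decidable (Bipartition.V₂ B) →
            Decidable (CutLabel B)
CutLabel? {F} B V₁? V₂? v =
  ∃?-bounded (labelsF F) (λ (_ , e , _) → proj₁ (Edge-labels v e)) λ s →
  ∃?-bounded (labelsF F) (λ (e , _) → proj₂ (Edge-labels v e)) λ t →
  Edge? v s t ×-dec ((V₁? s ×-dec V₂? t) ⊎-dec (V₂? s ×-dec V₁? t))

Kept : (F : Forest) → (Vertex F → Set) → Rel Label 0ℓ
Kept F I s t = ∃ λ v → ¬ I v × Edge F v s t

module _ {F : Forest} {I : Vertex F → Set} where

  Conn-trans : ∀ {s u t} → Conn F I s u → Conn F I u t → Conn F I s t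
  Conn-trans s~u refl                = s~u
  Conn-trans s~u (step v u~w ¬Iv e) = step v (Conn-trans s~u u~w) ¬Iv e

  Conn-sym : ∀ {s t} → Conn F I s t → Conn F I t s
  Conn-sym refl              = refl
  Conn-sym (step v s~u ¬Iv e) = Conn-trans (step v refl ¬Iv (Edge-sym v e)) (Conn-sym s~u)

  Conn⇔Star : ∀ {s t} → Conn F I s t ⇔ Star (Kept F I) s t
  Conn⇔Star = mk⇔ toStar fromStar
    where
      toStar : ∀ {s t} → Conn F I s t → Star (Kept F I) s t
      toStar refl              = ε
      toStar (step v s~u ¬Iv e) = toStar s~u ◅◅ ((v , ¬Iv , e) ◅ ε)

      fromStar : ∀ {s t} → Star (Kept F I) s t → Conn F I s t
      fromStar ε                      = refl
      fromStar ((v , ¬Iv , e) ◅ u⟶⋆t) = Conn-trans (step v refl ¬Iv e) (fromStar u⟶⋆t)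

module Components {F : Forest} {I : Vertex F → Set} (I? : Decidable I) where

  Kept? : Decidable₂ (Kept F I)
  Kept? s t = ∃?-bounded (vertices F) (λ {v} _ → ∈-vertices v) λ v → ¬? (I? v) ×-dec Edge? v s t

  Conn? : Decidable₂ (Conn F I)
  Conn? s t = map′ (from Conn⇔Star) (to Conn⇔Star) (reachable? s t)
    where open Reachability _≟ℕ_ Kept? (labelsF F) (λ (v , _ , e) → proj₂ (Edge-labels v e))

  componentSetoid : DecSetoid 0ℓ 0ℓ
  componentSetoid = record
    { Carrier = Label
    ; _≈_ = Conn F I
    ; isDecEquivalence = record
      { isEquivalence = record { refl = refl ; sym = Conn-sym ; trans = Conn-trans }
      ; _≟_ = Conn? } }

  representatives : List Label
  representatives = deduplicate Conn? (labelsF F)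

  representatives-cover : ∀ {s} → s ∈ labelsF F → Any (Conn F I s) representatives
  representatives-cover s∈ =
    Anyₚ.deduplicate⁺ Conn? (λ u~v s~v → Conn-trans s~v (Conn-sym u~v)) (Any.map (λ { refl → refl }) s∈)

  representatives-parts : Parts F I (length representatives)
  representatives-parts =
    representatives , refl ,
    All.tabulate (Anyₚ.deduplicate⁻ Conn?) ,
    deduplicate-! componentSetoid (labelsF F) ,
    λ _ → representatives-cover

  atLeastTwoParts : ∀ {s t} → s ∈ labelsF F → t ∈ labelsF F → ¬ Conn F I s t → AtLeastTwoParts F I
  atLeastTwoParts {s} {t} s∈ t∈ s≁t =
    length representatives , representatives-parts ,
    twoRepresentatives (representatives-cover s∈) (representatives-cover t∈)
    where
      twoRepresentatives : ∀ {rs} → Any (Conn F I s) rs → Any (Conn F I t) rs → 2 ≤ length rs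
      twoRepresentatives {_ ∷ _ ∷ _} _          _          = s≤s (s≤s z≤n)
      twoRepresentatives {_ ∷ []}    (here s~r) (here t~r) = ⊥-elim (s≁t (Conn-trans s~r (Conn-sym t~r)))

  componentBipartition : ∀ {r₁ r₂} → r₁ ∈ labelsF F → r₂ ∈ labelsF F → ¬ Conn F I r₁ r₂ → Bipartition F
  componentBipartition {r₁} {r₂} r₁∈ r₂∈ r₁≁r₂ = record
    { V₁ = λ s → s ∈ labelsF F × Conn F I s r₁
    ; V₂ = λ s → s ∈ labelsF F × ¬ Conn F I s r₁
    ; disjoint = λ _ (_ , s~r₁) (_ , s≁r₁) → s≁r₁ s~r₁
    ; cover = λ s → mk⇔ (side s) λ { (inj₁ (s∈ , _)) → s∈ ; (inj₂ (s∈ , _)) → s∈ }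
    ; nonempty₁ = r₁ , r₁∈ , refl
    ; nonempty₂ = r₂ , r₂∈ , r₁≁r₂ ∘ Conn-sym }
    where
      side : ∀ s → s ∈ labelsF F → (s ∈ labelsF F × Conn F I s r₁) ⊎ (s ∈ labelsF F × ¬ Conn F I s r₁)
      side s s∈ with Conn? s r₁
      ... | yes s~r₁ = inj₁ (s∈ , s~r₁)
      ... | no s≁r₁  = inj₂ (s∈ , s≁r₁)

  module _ {r₁ r₂} (r₁∈ : r₁ ∈ labelsF F) (r₂∈ : r₂ ∈ labelsF F) (r₁≁r₂ : ¬ Conn F I r₁ r₂) where

    private
      B = componentBipartition r₁∈ r₂∈ r₁≁r₂

    componentBipartition-cut? : Decidable (CutLabel B)
    componentBipartition-cut? =
      CutLabel? B (λ s → (s ∈? labelsF F) ×-dec Conn? s r₁) (λ s → (s ∈? labelsF F) ×-dec ¬? (Conn? s r₁))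

    -- An undeleted edge would join the two sides.
    componentBipartition-cut⊆ : CutLabel B ⊆ I
    componentBipartition-cut⊆ {v} (s , t , e , crossing) =
      decidable-stable (I? v) λ ¬Iv → let s~t = step v refl ¬Iv e in case crossing of λ where
        (inj₁ ((_ , s~r₁) , (_ , t≁r₁))) → t≁r₁ (Conn-trans (Conn-sym s~t) s~r₁)
        (inj₂ ((_ , s≁r₁) , (_ , t~r₁))) → s≁r₁ (Conn-trans s~t t~r₁)

prefixOfBipartition : ∀ {F k} (B : Bipartition F) → LabelSize B k →
                      Σ (Vertex F → Set) λ I → IsPrefix F I × HasSize I k × AtLeastTwoParts F I
prefixOfBipartition {F} B size =
  CutLabel B , CutLabel-isPrefix B , size ,
  atLeastTwoParts (from (cover _) (inj₁ s∈V₁)) (from (cover _) (inj₂ t∈V₂))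
                  (λ s~t → disjoint _ (V₁-closed s~t s∈V₁) t∈V₂)
  where
    open Bipartition B
    open Components (HasSize⇒Decidable _≟ᵛ_ size)

    s∈V₁ : V₁ (proj₁ nonempty₁)
    s∈V₁ = proj₂ nonempty₁

    t∈V₂ : V₂ (proj₁ nonempty₂)
    t∈V₂ = proj₂ nonempty₂

    V₁-closed : ∀ {a b} → Conn F (CutLabel B) a b → V₁ a → V₁ b
    V₁-closed refl                 a∈V₁ = a∈V₁
    V₁-closed (step v a~u ¬cut e) a∈V₁ with to (cover _) (proj₂ (Edge-labels v e))
    ... | inj₁ b∈V₁ = b∈V₁
    ... | inj₂ b∈V₂ = ⊥-elim (¬cut (_ , _ , e , inj₁ (V₁-closed a~u a∈V₁ , b∈V₂)))

bipartitionOfParts : ∀ {F k} {I : Vertex F → Set} → HasSize I k → AtLeastTwoParts F I →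
                     Σ (Bipartition F) λ B → ∃ λ k′ → LabelSize B k′ × k′ ≤ k
bipartitionOfParts size (_ , (_ ∷ _ ∷ _ , _ , r₁∈ ∷ r₂∈ ∷ _ , (r₁≁r₂ ∷ _) ∷ _ , _) , _) =
  componentBipartition r₁∈ r₂∈ r₁≁r₂ ,
  HasSize-⊆ (componentBipartition-cut? r₁∈ r₂∈ r₁≁r₂) (componentBipartition-cut⊆ r₁∈ r₂∈ r₁≁r₂) size
  where open Components (HasSize⇒Decidable _≟ᵛ_ size)
bipartitionOfParts _ (_ , ([] , refl , _) , ())
bipartitionOfParts _ (_ , (_ ∷ [] , refl , _) , s≤s ())

lemma3 : (F : Forest) (k : ℕ) → MinCut F k ⇔ MinPrefix F k
lemma3 F k = mk⇔ minCut⇒minPrefix minPrefix⇒minCut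
  where
    CutBound PrefixBound : Set₁
    CutBound    = ∀ (B : Bipartition F) k′ → LabelSize B k′ → k ≤ k′
    PrefixBound = ∀ (I : Vertex F → Set) k′ → IsPrefix F I → HasSize I k′ → AtLeastTwoParts F I → k ≤ k′

    cutBound⇒prefixBound : CutBound → PrefixBound
    cutBound⇒prefixBound bound I k′ _ size two =
      let (B , k″ , size′ , k″≤k′) = bipartitionOfParts size two in ≤-trans (bound B k″ size′) k″≤k′

    prefixBound⇒cutBound : PrefixBound → CutBound
    prefixBound⇒cutBound bound B k′ size =
      let (I , prefix , size′ , two) = prefixOfBipartition B size in bound I k′ prefix size′ two

    minCut⇒minPrefix : MinCut F k → MinPrefix F k
    minCut⇒minPrefix ((B , size) , minimal) = prefixOfBipartition B size , cutBound⇒prefixBound minimal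

    minPrefix⇒minCut : MinPrefix F k → MinCut F k
    minPrefix⇒minCut ((I , _ , size , two) , minimal) with bipartitionOfParts size two
    ... | B , k′ , size′ , k′≤k =
      (B , subst (LabelSize B) (≤-antisym k′≤k (prefixBound⇒cutBound minimal B k′ size′)) size′) ,
      prefixBound⇒cutBound minimal
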